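{- Let $\{a_n\}_{n\ge0}$ be a sequence of complex numbers and let $b_n=\sum_{k=0}^n\binom{n}{k}a_k$ for $n\ge 0$. Then for every two integers $0\le m\le n$, $$\sum_{k=0}^n\binom{n}{k}k(k-1)\cdots(k-m+1)\,a_k=m!\binom{n}{m}\nabla^m b_n,$$ equivalently, $$\sum_{k=0}^n\binom{n}{k}\binom{k}{m}a_k=\binom{n}{m}\nabla^m b_n .$$
   Context: $\nabla$ denotes the backward difference operator on the sequence $\{b_n\}$: $\nabla b_n=b_n-b_{n-1}$, $\nabla^0 b_n=b_n$, and $\nabla^m b_n=\nabla^{m-1}b_n-\nabla^{m-1}b_{n-1}$. For $m=0$ the product $k(k-1)\cdots(k-m+1)$ is the empty product $1$. -}

module Defs where

open import Level using (Level)
open import Data.Nat using (ℕ; zero; suc; _∸_)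
open import Algebra.Bundles using (CommutativeRing)

module _ {c ℓ : Level} (R : CommutativeRing c ℓ) where
  open CommutativeRing R using (Carrier; _+_; _-_; +-rawMonoid)
  open import Algebra.Definitions.RawMonoid +-rawMonoid using (_×_)

  _·ℕ_ : ℕ → Carrier → Carrier
  k ·ℕ x = k × x

  Σ≤ : (ℕ → Carrier) → ℕ → Carrier
  Σ≤ f zero    = f zero
  Σ≤ f (suc n) = Σ≤ f n + f (suc n)

  -- backward difference: ∇ b 0 n = b n, ∇ b (m+1) n = ∇ b m n - ∇ b m (n-1)
  -- (only used with m ≤ n, so the truncated subtraction n ∸ 1 never truncates)
  ∇ : (ℕ → Carrier) → ℕ → ℕ → Carrier
  ∇ b zero    n = b n
  ∇ b (suc m) n = ∇ b m n - ∇ b m (n ∸ 1)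

module Submission where

-- Write n = m + N.  The proof rests on a closed form for the iterated
-- backward difference of b_n = Σ_k C(n,k) a_k:
--
--     ∇^m b_{m+N} = Σ_{k ≤ m+N} C(N, k − m) a_k      (C(N, k − m) = 0 for k < m),
--
-- proved by induction on m: Pascal's rule C(N+1, j) = C(N, j) + C(N, j − 1)
-- splits ∇^m b_{m+N+1} into ∇^m b_{m+N} plus the claimed sum for m + 1.
-- The theorem then follows from the coefficient identities
--
--     C(n,k) C(k,m)   = C(n,m) C(n − m, k − m)      (subsets of subsets),
--     C(n,k) k^{(m)}  = m! C(n,m) C(n − m, k − m)   (k^{(m)} = k P m = m! C(k,m)).

open import Defs
open import Level using (Level)
open import Data.Nat using (ℕ; _≤_; _*_)
open import Data.Nat.Combinatorics using (_C_; _P_)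
open import Data.Nat.Base using (_!)
open import Data.Product using (_,_) renaming (_×_ to _∧_)
open import Algebra.Bundles using (CommutativeRing)
open import Data.Nat.Properties using (m≤n⇒∃[o]m+o≡n)
import Relation.Binary.PropositionalEquality as ≡

module Binomial where
  open import Data.Nat.Base using (zero; suc; _+_; _∸_; s≤s)
  open import Data.Nat.Properties
  open import Data.Nat.Combinatorics
    using (nCk≡n!/k![n-k]!; nPk≡n!/[n∸k]!; k>n⇒nCk≡0; k>n⇒nPk≡0;
           k![n∸k]!∣n!; [n∸k]!k!∣n!; nCk+nC[k+1]≡[n+1]C[k+1])
  open import Data.Nat.DivMod using (_/_; m/n*n≡m)
  open import Data.Nat.Divisibility using (∣-trans; m∣m*n)
  open import Data.Nat.Tactic.RingSolver using (solve-∀)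
  open import Relation.Nullary using (yes; no)
  open import Relation.Binary.PropositionalEquality
  open ≡-Reasoning
  open import Algebra.Properties.CommutativeSemigroup *-commutativeSemigroup using (x∙yz≈yx∙z; x∙yz≈y∙xz)

  binomial-factorials : ∀ {n k} → k ≤ n → (n C k) * (k ! * (n ∸ k) !) ≡ n !
  binomial-factorials {n} {k} k≤n = begin
    (n C k) * (k ! * (n ∸ k) !)                 ≡⟨ cong (_* (k ! * (n ∸ k) !)) (nCk≡n!/k![n-k]! k≤n) ⟩
    n ! / (k ! * (n ∸ k) !) * (k ! * (n ∸ k) !) ≡⟨ m/n*n≡m (k![n∸k]!∣n! k≤n) ⟩
    n !                                         ∎
    where instance _ = k !* (n ∸ k) !≢0

  falling-factorials : ∀ {n k} → k ≤ n → (n P k) * (n ∸ k) ! ≡ n !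
  falling-factorials {n} {k} k≤n = begin
    (n P k) * (n ∸ k) !             ≡⟨ cong (_* (n ∸ k) !) (nPk≡n!/[n∸k]! k≤n) ⟩
    n ! / (n ∸ k) ! * (n ∸ k) !     ≡⟨ m/n*n≡m (∣-trans (m∣m*n (k !)) ([n∸k]!k!∣n! k≤n)) ⟩
    n !                             ∎
    where instance _ = (n ∸ k) !≢0

  -- The falling factorial k(k−1)⋯(k−m+1) counts ordered m-subsets: m! C(k,m).
  -- Both sides vanish for k < m; otherwise cancel (k−m)! in the formulas above.
  P≡!*C : ∀ k m → k P m ≡ m ! * (k C m)
  P≡!*C k m with m ≤? k
  ... | yes m≤k = *-cancelʳ-≡ (k P m) (m ! * (k C m)) ((k ∸ m) !) {{(k ∸ m) !≢0}} (begin
    (k P m) * (k ∸ m) !           ≡⟨ falling-factorials m≤k ⟩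
    k !                           ≡⟨ binomial-factorials m≤k ⟨
    (k C m) * (m ! * (k ∸ m) !)   ≡⟨ x∙yz≈yx∙z (k C m) (m !) ((k ∸ m) !) ⟩
    m ! * (k C m) * (k ∸ m) !     ∎)
  ... | no m≰k = begin
    k P m             ≡⟨ k>n⇒nPk≡0 (≰⇒> m≰k) ⟩
    0                 ≡⟨ *-zeroʳ (m !) ⟨
    m ! * 0           ≡⟨ cong (m ! *_) (k>n⇒nCk≡0 (≰⇒> m≰k)) ⟨
    m ! * (k C m)     ∎

  absorption : ∀ n k → suc k * (suc n C suc k) ≡ suc n * (n C k)
  absorption n k with k ≤? n
  ... | yes k≤n = *-cancelʳ-≡ _ _ (k ! * (n ∸ k) !) {{k !* (n ∸ k) !≢0}} (begin
    suc k * (suc n C suc k) * (k ! * (n ∸ k) !)  ≡⟨ regroup (suc k) (suc n C suc k) (k !) ((n ∸ k) !) ⟩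
    (suc n C suc k) * (suc k ! * (n ∸ k) !)      ≡⟨ binomial-factorials (s≤s k≤n) ⟩
    suc n !                                      ≡⟨ cong (suc n *_) (binomial-factorials k≤n) ⟨
    suc n * ((n C k) * (k ! * (n ∸ k) !))        ≡⟨ *-assoc (suc n) (n C k) (k ! * (n ∸ k) !) ⟨
    suc n * (n C k) * (k ! * (n ∸ k) !)          ∎)
    where
    regroup : ∀ a c f d → a * c * (f * d) ≡ c * (a * f * d)
    regroup = solve-∀
  ... | no k≰n = begin
    suc k * (suc n C suc k)   ≡⟨ cong (suc k *_) (k>n⇒nCk≡0 (s≤s (≰⇒> k≰n))) ⟩
    suc k * 0                 ≡⟨ *-zeroʳ (suc k) ⟩
    0                         ≡⟨ *-zeroʳ (suc n) ⟨
    suc n * 0                 ≡⟨ cong (suc n *_) (k>n⇒nCk≡0 (≰⇒> k≰n)) ⟨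
    suc n * (n C k)           ∎

  -- Shifted binomial coefficient: shiftC m N k = C(N, k − m) for m ≤ k and 0
  -- for k < m.  It is the coefficient of a_k in ∇^m b_{m+N}.
  shiftC : ℕ → ℕ → ℕ → ℕ
  shiftC zero    N k       = N C k
  shiftC (suc m) N zero    = 0
  shiftC (suc m) N (suc k) = shiftC m N k

  -- Pascal's rule, in the shape needed to pass from ∇^m to ∇^(m+1).
  shiftC-pascal : ∀ m N k → shiftC m (suc N) k ≡ shiftC m N k + shiftC (suc m) N k
  shiftC-pascal zero    N zero    = refl
  shiftC-pascal zero    N (suc k) = begin
    suc N C suc k           ≡⟨ nCk+nC[k+1]≡[n+1]C[k+1] N k ⟨
    N C k + N C suc k       ≡⟨ +-comm (N C k) (N C suc k) ⟩
    N C suc k + N C k       ∎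
  shiftC-pascal (suc m) N zero    = refl
  shiftC-pascal (suc m) N (suc k) = shiftC-pascal m N k

  shiftC-beyond : ∀ m N → shiftC m N (suc (m + N)) ≡ 0
  shiftC-beyond zero    N = k>n⇒nCk≡0 (n<1+n N)
  shiftC-beyond (suc m) N = shiftC-beyond m N

  -- C(n,k) C(k,m) = C(n,m) C(n−m, k−m) with n = m + N, for every k.  Induction on
  -- m: after multiplying by m+1, three uses of absorption reduce to the case m−1.
  subset-of-subset : ∀ m N k → ((m + N) C k) * (k C m) ≡ ((m + N) C m) * shiftC m N k
  subset-of-subset zero    N k       = trans (*-identityʳ (N C k)) (sym (*-identityˡ (N C k)))
  subset-of-subset (suc m) N zero    = trans (*-zeroʳ ((suc m + N) C 0)) (sym (*-zeroʳ ((suc m + N) C suc m)))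
  subset-of-subset (suc m) N (suc k) = *-cancelˡ-≡ _ _ (suc m) (begin
    suc m * ((n′ C suc k) * (suc k C suc m))  ≡⟨ x∙yz≈y∙xz (suc m) (n′ C suc k) (suc k C suc m) ⟩
    (n′ C suc k) * (suc m * (suc k C suc m))  ≡⟨ cong ((n′ C suc k) *_) (absorption k m) ⟩
    (n′ C suc k) * (suc k * (k C m))          ≡⟨ x∙yz≈yx∙z (n′ C suc k) (suc k) (k C m) ⟩
    (suc k * (n′ C suc k)) * (k C m)          ≡⟨ cong (_* (k C m)) (absorption n k) ⟩
    (n′ * (n C k)) * (k C m)                  ≡⟨ *-assoc n′ (n C k) (k C m) ⟩
    n′ * ((n C k) * (k C m))                  ≡⟨ cong (n′ *_) (subset-of-subset m N k) ⟩
    n′ * ((n C m) * shiftC m N k)             ≡⟨ *-assoc n′ (n C m) (shiftC m N k) ⟨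
    (n′ * (n C m)) * shiftC m N k             ≡⟨ cong (_* shiftC m N k) (absorption n m) ⟨
    (suc m * (n′ C suc m)) * shiftC m N k     ≡⟨ *-assoc (suc m) (n′ C suc m) (shiftC m N k) ⟩
    suc m * ((n′ C suc m) * shiftC m N k)     ∎)
    where
    n = m + N
    n′ = suc n

  ordered-subset-of-subset : ∀ m N k →
    ((m + N) C k) * (k P m) ≡ (m ! * ((m + N) C m)) * shiftC m N k
  ordered-subset-of-subset m N k = begin
    (n C k) * (k P m)                 ≡⟨ cong ((n C k) *_) (P≡!*C k m) ⟩
    (n C k) * (m ! * (k C m))         ≡⟨ x∙yz≈y∙xz (n C k) (m !) (k C m) ⟩
    m ! * ((n C k) * (k C m))         ≡⟨ cong (m ! *_) (subset-of-subset m N k) ⟩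
    m ! * ((n C m) * shiftC m N k)    ≡⟨ *-assoc (m !) (n C m) (shiftC m N k) ⟨
    (m ! * (n C m)) * shiftC m N k    ∎
    where n = m + N

open Binomial

module BackwardDifferences {c ℓ : Level} (R : CommutativeRing c ℓ) where
  open import Data.Nat.Base as ℕ using (zero; suc)
  open import Data.Nat.Properties using (+-suc)
  open ≡ using (_≡_)
  open CommutativeRing R using (Carrier; _≈_; _+_; _-_; -‿cong; 0#; refl; sym; trans; setoid;
                                +-cong; +-congˡ; +-congʳ; +-identityʳ;
                                +-monoid; +-commutativeMonoid; +-abelianGroup; +-commutativeSemigroup)
  open import Algebra.Properties.Monoid.Mult +-monoid using (×-congʳ; ×-congˡ; ×-homo-0; ×-homo-+; ×-assocˡ)
  open import Algebra.Properties.CommutativeMonoid.Mult +-commutativeMonoid using (×-distrib-+)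
  open import Algebra.Properties.CommutativeSemigroup +-commutativeSemigroup using (interchange)
  open import Algebra.Properties.AbelianGroup +-abelianGroup using (xyx⁻¹≈y)
  open import Relation.Binary.Reasoning.Setoid setoid

  infixr 8 _·_
  _·_ : ℕ → Carrier → Carrier
  _·_ = _·ℕ_ R

  Σ : (ℕ → Carrier) → ℕ → Carrier
  Σ = Σ≤ R

  Σ-cong : ∀ {f g} → (∀ i → f i ≈ g i) → ∀ n → Σ f n ≈ Σ g n
  Σ-cong f≈g zero    = f≈g zero
  Σ-cong f≈g (suc n) = +-cong (Σ-cong f≈g n) (f≈g (suc n))

  Σ-+ : ∀ f g n → Σ (λ i → f i + g i) n ≈ Σ f n + Σ g n
  Σ-+ f g zero    = refl
  Σ-+ f g (suc n) = trans (+-congʳ (Σ-+ f g n)) (interchange (Σ f n) (Σ g n) (f (suc n)) (g (suc n)))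

  Σ-· : ∀ K f n → K · Σ f n ≈ Σ (λ i → K · f i) n
  Σ-· K f zero    = refl
  Σ-· K f (suc n) = trans (×-distrib-+ (Σ f n) (f (suc n)) K) (+-congʳ (Σ-· K f n))

  Σ-drop-last : ∀ f n → f (suc n) ≈ 0# → Σ f (suc n) ≈ Σ f n
  Σ-drop-last f n f[n+1]≈0 = trans (+-congˡ f[n+1]≈0) (+-identityʳ (Σ f n))

  module _ (a : ℕ → Carrier) where

    b : ℕ → Carrier
    b j = Σ (λ k → (j C k) · a k) j

    term : ℕ → ℕ → ℕ → Carrier
    term m N k = shiftC m N k · a k

    -- In the inductive
    -- step, ∇^m b_{m+N+1} = ∇^m b_{m+N} + Σ (term (m+1) N) by Pascal's rule, so
    -- the difference ∇^(m+1) b_{m+N+1} is exactly the second sum.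
    ∇-closed-form : ∀ m N → ∇ R b m (m ℕ.+ N) ≈ Σ (term m N) (m ℕ.+ N)
    ∇-closed-form zero    N = refl
    ∇-closed-form (suc m) N = begin
      ∇ R b m (suc n) - ∇ R b m n                                  ≈⟨ +-cong upper (-‿cong (∇-closed-form m N)) ⟩
      Σ (term m (suc N)) (suc n) - Σ (term m N) n                  ≈⟨ +-congʳ split ⟩
      (Σ (term m N) n + Σ (term (suc m) N) (suc n)) - Σ (term m N) n ≈⟨ xyx⁻¹≈y (Σ (term m N) n) _ ⟩
      Σ (term (suc m) N) (suc n)                                   ∎
      where
      n = m ℕ.+ N

      upper : ∇ R b m (suc n) ≈ Σ (term m (suc N)) (suc n)
      upper = ≡.subst (λ j → ∇ R b m j ≈ Σ (term m (suc N)) j) (+-suc m N) (∇-closed-form m (suc N))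

      term-pascal : ∀ k → term m (suc N) k ≈ term m N k + term (suc m) N k
      term-pascal k = trans (×-congˡ (shiftC-pascal m N k)) (×-homo-+ (a k) (shiftC m N k) (shiftC (suc m) N k))

      split : Σ (term m (suc N)) (suc n) ≈ Σ (term m N) n + Σ (term (suc m) N) (suc n)
      split = begin
        Σ (term m (suc N)) (suc n)                              ≈⟨ Σ-cong term-pascal (suc n) ⟩
        Σ (λ k → term m N k + term (suc m) N k) (suc n)         ≈⟨ Σ-+ (term m N) (term (suc m) N) (suc n) ⟩
        Σ (term m N) (suc n) + Σ (term (suc m) N) (suc n)       ≈⟨ +-congʳ (Σ-drop-last (term m N) n beyond) ⟩
        Σ (term m N) n + Σ (term (suc m) N) (suc n)             ∎
        where
        beyond : term m N (suc n) ≈ 0#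
        beyond = trans (×-congˡ (shiftC-beyond m N)) (×-homo-0 (a (suc n)))

    weighted-sum : ∀ m N {w : ℕ → ℕ} (K : ℕ) → (∀ k → w k ≡ K ℕ.* shiftC m N k) →
                   Σ (λ k → w k · a k) (m ℕ.+ N) ≈ K · ∇ R b m (m ℕ.+ N)
    weighted-sum m N {w} K w≡K*shiftC = begin
      Σ (λ k → w k · a k) n         ≈⟨ Σ-cong rescale n ⟩
      Σ (λ k → K · term m N k) n    ≈⟨ Σ-· K (term m N) n ⟨
      K · Σ (term m N) n            ≈⟨ ×-congʳ K (∇-closed-form m N) ⟨
      K · ∇ R b m n                 ∎
      where
      n = m ℕ.+ N

      rescale : ∀ k → w k · a k ≈ K · term m N k
      rescale k = trans (×-congˡ (w≡K*shiftC k)) (sym (×-assocˡ (a k) K (shiftC m N k)))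

lemma1 : ∀ {c ℓ : Level} (R : CommutativeRing c ℓ) (a : ℕ → CommutativeRing.Carrier R)
           (m n : ℕ) → m ≤ n →
           let open CommutativeRing R using (_≈_)
               b = λ (j : ℕ) → Σ≤ R (λ k → _·ℕ_ R (j C k) (a k)) j
           in (Σ≤ R (λ k → _·ℕ_ R ((n C k) * (k P m)) (a k)) n
                 ≈ _·ℕ_ R ((m !) * (n C m)) (∇ R b m n))
              ∧ (Σ≤ R (λ k → _·ℕ_ R ((n C k) * (k C m)) (a k)) n
                 ≈ _·ℕ_ R (n C m) (∇ R b m n))
lemma1 R a m n m≤n with N , ≡.refl ← m≤n⇒∃[o]m+o≡n m≤n =
  weighted-sum a m N (m ! * (n C m)) (ordered-subset-of-subset m N)
  , weighted-sum a m N (n C m) (subset-of-subset m N)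
  where open BackwardDifferences R
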